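{- Let $(i,c)$ be an $I$-pointed partially observable $FT(\_)^A$-coalgebra, i.e. $i\colon I\to S$ and $c=\langle\delta,\mathrm{obs}\rangle\colon S\to (FTS)^A\times O$ with $\delta\colon S\to (FTS)^A$ and $\mathrm{obs}\colon S\to O$. Assume: (1) $\tau=\rho\circ F\sigma$ for some monotone algebra $\rho\colon F\Omega\to\Omega$ and some monotone Eilenberg–Moore algebra $\sigma\colon T\Omega\to\Omega$ of $T$ such that $\sigma\circ T\rho=\rho\circ F\sigma\circ\lambda_\Omega$ and $\bot_{TX}=\sigma\circ T(\bot_X)$ for every object $X$; (2) $T\langle \mathrm{id}_S,\mathrm{obs}\rangle\circ\iota_{\mathrm{obs}}=\mathrm{st}\circ\langle\iota_{\mathrm{obs}},\overline{T}_O(\mathrm{obs})\rangle$ as morphisms $\overline{T}_O S_{\mathrm{obs}}\to T(S\times O)$, where $\mathrm{st}\colon TS\times O\to T(S\times O)$ is the strength of $T$. Then $V(i,c)=V(\mathsf{Bel}(i,c))$ as morphisms $I\to\Omega$.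
   Context: Setting. $\mathcal{C}$ is a cartesian closed category with finite products, pullbacks (a choice of pullback squares is fixed) and countable coproducts. For $f\colon X\times Y\to Z$, $f^\dagger\colon X\to Z^Y$ is its adjoint transpose (and for $g\colon X\to Z^Y$, $g^\dagger\colon X\times Y\to Z$). $\mathcal{O}$ is a wide subcategory of $\mathcal{C}$ (containing all objects). $T=(T,\eta,\mu)$ is a strong monad with strength $\mathrm{st}^T_{X,Y}\colon X\times TY\to T(X\times Y)$, $F$ is a strong endofunctor with strength $\mathrm{st}^F_{X,Y}\colon X\times FY\to F(X\times Y)$, and $\lambda\colon TF\Rightarrow FT$ is a distributive law: a natural transformation with $\lambda_X\circ\eta_{FX}=F\eta_X$ and $F\mu_X\circ\lambda_{TX}\circ T\lambda_X=\lambda_X\circ\mu_{FX}$, which moreover satisfies $\lambda_{X\times Y}\circ T(\mathrm{st}^F_{X,Y})\circ\mathrm{st}^T_{X,FY}=F(\mathrm{st}^T_{X,Y})\circ\mathrm{st}^F_{X,TY}\circ(X\times\lambda_Y)$. We write $\mathrm{st}$ for the strengths of $T$, $F$ and of $FT$ (namely $F\mathrm{st}^T\circ\mathrm{st}^F$), applied on either side via the symmetry of $\times$. $A$ (actions) and $I$ are fixed objects. Order. $\Omega$ is an ordered object: every hom-set $\mathcal{C}(X,\Omega)$ is a complete lattice and every precomposition map preserves arbitrary joins; $\bot_X$ is the bottom of $\mathcal{C}(X,\Omega)$. An algebra $\rho\colon G\Omega\to\Omega$ of an endofunctor $G$ is monotone if $g\mapsto\rho\circ Gg$, $\mathcal{C}(X,\Omega)\to\mathcal{C}(GX,\Omega)$,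 is monotone for each $X$. A fixed monotone algebra $\tau\colon FT\Omega\to\Omega$ is given. For an $FT$-coalgebra $e\colon X\to FTX$ define $\Phi_e\colon\mathcal{C}(X,\Omega)\to\mathcal{C}(X,\Omega)$ by $\Phi_e(g)=\tau\circ FTg\circ e$. Sequences. $X^*=\coprod_{n\ge0}X^n$, $X^+=\coprod_{n\ge1}X^n$ (functorial in $X$); $\mathsf{cons}_O\colon O\times O^*\to O^+$ is the canonical isomorphism; $O^*\cong 1+O^+$ induces $A^{O^*}\cong A\times A^{O^+}$; $\mathrm{ev}\colon O\times A^{O^+}\to A^{O^*}$ is the transpose of $O\times A^{O^+}\times O^*\to A$, $(o,h,w)\mapsto h(\mathsf{cons}_O(o,w))$ (i.e. evaluation after $\mathsf{cons}_O$). Schedulers. For $c=\langle\delta,\mathrm{obs}\rangle\colon S\to (FTS)^A\times O$, $\mathsf{Sch}(c)\colon S\times A^{O^*}\to FT(S\times A^{O^*})$ is the composite $S\times A^{O^*}\cong S\times A\times A^{O^+}\xrightarrow{\delta^\dagger\times\mathrm{id}}FTS\times A^{O^+}\xrightarrow{\mathrm{st}}FT(S\times A^{O^+})\xrightarrow{FT\langle\pi_1,\mathrm{ev}\circ(\mathrm{obs}\times\mathrm{id})\rangle}FT(S\times A^{O^*})$. For a pointed coalgebra $(i,c)$ with $i\colon I\to S$, $V(i,c):=\bigvee_{u\colon O^+\to A,\,n\in\mathbb{N}}\Phi^n_{\mathsf{Sch}(c)}(\bot)\circ\langle\mathrm{id}_S,(u\circ\mathsf{cons}_O)^\dagger\circ\mathrm{obs}\rangle\circ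 i\colon I\to\Omega$. Slice monads. For $f\colon X\to O$, the object $\overline{T}_OX_f$ with morphisms $\overline{T}_O(f)\colon\overline{T}_OX_f\to O$ and $\iota_f\colon\overline{T}_OX_f\to TX$ is the chosen pullback of $\eta_O\colon O\to TO$ along $Tf\colon TX\to TO$; this gives an endofunctor $\overline{T}_O$ of the slice category $\mathcal{C}/O$ (on morphisms by universality), which is a monad (induced by the Eilenberg–Moore adjunction sliced over $O$), with unit $\eta^{\overline{T}}_f\colon X\to\overline{T}_OX_f$ the morphism induced by the pair $(\eta_X,f)$. Let $d\colon\mathcal{C}/O\to\mathcal{C}$ be the forgetful functor. For $u\colon O\to O'$ and $f\colon X\to O$, $\theta_{u,f}\colon\overline{T}_OX_f\to\overline{T}_{O'}X_{u\circ f}$ is induced by the pair $(\iota_f,u\circ\overline{T}_O(f))$. Let $\mathsf{flat}^O_f:=\mu_X\circ T\iota_f\colon T(\overline{T}_OX_f)\to TX$. Belief decomposition. A fixed family of natural transformations $\alpha^O\colon Td\Rightarrow Td\overline{T}_O$ (components $\alpha^O_f\colon TX\to T(\overline{T}_OX_f)$), one for each object $O$, with $\mathsf{flat}^O_f\circ\alpha^O_f=\mathrm{id}_{TX}$ and $T(\theta_{u,f})\circ\alpha^O_f=\alpha^{O'}_{u\circ f}$ for every $u\colon O\to O'$ in $\mathcal{O}$. Belief coalgebra. Let $\kappa_Y\colon T(Y^A)\to (TY)^A$ be the transpose of $T(Y^A)\times A\xrightarrow{\mathrm{st}}T(Y^A\times A)\xrightarrow{T\mathrm{ev}}TY$, and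 $\lambda'_X:=(\lambda_X)^A\circ\kappa_{FX}\colon T((FX)^A)\to (FTX)^A$. For $c=\langle\delta,\mathrm{obs}\rangle$ set $c^{\mathsf{Bel}}:=(F\alpha^O_{\mathrm{obs}})^A\circ(F\mu_S)^A\circ\lambda'_{TS}\circ T\delta\circ\iota_{\mathrm{obs}}\colon\overline{T}_OS_{\mathrm{obs}}\to (FT(\overline{T}_OS_{\mathrm{obs}}))^A$ and $\mathsf{Bel}(i,c):=(\eta^{\overline{T}}_{\mathrm{obs}}\circ i,\ \langle c^{\mathsf{Bel}},\overline{T}_O(\mathrm{obs})\rangle)$, an $I$-pointed partially observable coalgebra with state object $\overline{T}_OS_{\mathrm{obs}}$ and observation object $O$. -}

module Defs where

open import Level using (Level; _⊔_) renaming (suc to lsuc)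
open import Data.Nat using (ℕ; zero; suc)
open import Data.Product using (Σ; _,_)
open import Data.Empty.Polymorphic using (⊥; ⊥-elim)
open import Relation.Binary.PropositionalEquality
  using (_≡_; refl; sym; trans; cong; cong₂; module ≡-Reasoning)

record Setting (o ℓ : Level) : Set (lsuc (o ⊔ ℓ)) where
  infixr 9 _∘_
  infixr 7 _×_
  infix 4 _≤_
  field
    Obj : Set o
    Hom : Obj → Obj → Set ℓ
    id  : ∀ {X} → Hom X X
    _∘_ : ∀ {X Y Z} → Hom Y Z → Hom X Y → Hom X Z
    identityˡ : ∀ {X Y} {f : Hom X Y} → id ∘ f ≡ f
    identityʳ : ∀ {X Y} {f : Hom X Y} → f ∘ id ≡ f
    assoc : ∀ {W X Y Z} {f : Hom Y Z} {g : Hom X Y} {h : Hom W X} →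
            (f ∘ g) ∘ h ≡ f ∘ (g ∘ h)

    𝟙 : Obj
    ! : ∀ {X} → Hom X 𝟙
    !-unique : ∀ {X} (f : Hom X 𝟙) → f ≡ !

    _×_ : Obj → Obj → Obj
    π₁ : ∀ {X Y} → Hom (X × Y) X
    π₂ : ∀ {X Y} → Hom (X × Y) Y
    ⟨_,_⟩ : ∀ {W X Y} → Hom W X → Hom W Y → Hom W (X × Y)
    π₁-β : ∀ {W X Y} {f : Hom W X} {g : Hom W Y} → π₁ ∘ ⟨ f , g ⟩ ≡ f
    π₂-β : ∀ {W X Y} {f : Hom W X} {g : Hom W Y} → π₂ ∘ ⟨ f , g ⟩ ≡ g
    ⟨⟩-unique : ∀ {W X Y} {f : Hom W X} {g : Hom W Y} {h : Hom W (X × Y)} →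
                π₁ ∘ h ≡ f → π₂ ∘ h ≡ g → h ≡ ⟨ f , g ⟩

    -- exponentials (Z ^ Y is Z^Y); curry f is f^†
    _^_ : Obj → Obj → Obj
    eval : ∀ {Y Z} → Hom ((Z ^ Y) × Y) Z
    curry : ∀ {X Y Z} → Hom (X × Y) Z → Hom X (Z ^ Y)
    curry-β : ∀ {X Y Z} {f : Hom (X × Y) Z} →
              eval ∘ ⟨ curry f ∘ π₁ , π₂ ⟩ ≡ f
    curry-unique : ∀ {X Y Z} {f : Hom (X × Y) Z} {g : Hom X (Z ^ Y)} →
                   eval ∘ ⟨ g ∘ π₁ , π₂ ⟩ ≡ f → g ≡ curry f

    PB : ∀ {X Y Z} → Hom X Z → Hom Y Z → Obj
    pb₁ : ∀ {X Y Z} {f : Hom X Z} {g : Hom Y Z} → Hom (PB f g) X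
    pb₂ : ∀ {X Y Z} {f : Hom X Z} {g : Hom Y Z} → Hom (PB f g) Y
    pb-comm : ∀ {X Y Z} {f : Hom X Z} {g : Hom Y Z} → f ∘ pb₁ {f = f} {g} ≡ g ∘ pb₂
    pbu : ∀ {W X Y Z} {f : Hom X Z} {g : Hom Y Z} (h : Hom W X) (k : Hom W Y) →
          .(f ∘ h ≡ g ∘ k) → Hom W (PB f g)
    pbu-β₁ : ∀ {W X Y Z} {f : Hom X Z} {g : Hom Y Z} {h : Hom W X} {k : Hom W Y}
             .(e : f ∘ h ≡ g ∘ k) → pb₁ ∘ pbu h k e ≡ h
    pbu-β₂ : ∀ {W X Y Z} {f : Hom X Z} {g : Hom Y Z} {h : Hom W X} {k : Hom W Y}
             .(e : f ∘ h ≡ g ∘ k) → pb₂ ∘ pbu h k e ≡ k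
    pbu-unique : ∀ {W X Y Z} {f : Hom X Z} {g : Hom Y Z} {h : Hom W X} {k : Hom W Y}
                 .(e : f ∘ h ≡ g ∘ k) {u : Hom W (PB f g)} →
                 pb₁ ∘ u ≡ h → pb₂ ∘ u ≡ k → u ≡ pbu h k e

    ∐ : (ℕ → Obj) → Obj
    inj : ∀ {D : ℕ → Obj} (n : ℕ) → Hom (D n) (∐ D)
    copair : ∀ {D : ℕ → Obj} {Z} → ((n : ℕ) → Hom (D n) Z) → Hom (∐ D) Z
    copair-β : ∀ {D : ℕ → Obj} {Z} {fs : (n : ℕ) → Hom (D n) Z} (n : ℕ) →
               copair fs ∘ inj n ≡ fs n
    copair-unique : ∀ {D : ℕ → Obj} {Z} {fs : (n : ℕ) → Hom (D n) Z} {h : Hom (∐ D) Z} →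
                    (∀ n → h ∘ inj n ≡ fs n) → h ≡ copair fs

    -- the wide subcategory 𝒪 (a class of morphisms containing identities,
    -- closed under composition)
    In𝒪 : ∀ {X Y} → Hom X Y → Set ℓ
    𝒪-id : ∀ {X} → In𝒪 (id {X})
    𝒪-∘ : ∀ {X Y Z} {f : Hom Y Z} {g : Hom X Y} → In𝒪 f → In𝒪 g → In𝒪 (f ∘ g)

    T₀ : Obj → Obj
    T₁ : ∀ {X Y} → Hom X Y → Hom (T₀ X) (T₀ Y)
    T-id : ∀ {X} → T₁ (id {X}) ≡ id
    T-∘ : ∀ {X Y Z} {f : Hom Y Z} {g : Hom X Y} → T₁ (f ∘ g) ≡ T₁ f ∘ T₁ g
    η : ∀ {X} → Hom X (T₀ X)
    μ : ∀ {X} → Hom (T₀ (T₀ X)) (T₀ X)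
    η-natural : ∀ {X Y} (f : Hom X Y) → η ∘ f ≡ T₁ f ∘ η
    μ-natural : ∀ {X Y} (f : Hom X Y) → μ ∘ T₁ (T₁ f) ≡ T₁ f ∘ μ
    μ-ηT : ∀ {X} → μ ∘ η {T₀ X} ≡ id
    μ-Tη : ∀ {X} → μ ∘ T₁ (η {X}) ≡ id
    μ-assoc : ∀ {X} → μ ∘ T₁ (μ {X}) ≡ μ ∘ μ
    stT : ∀ {X Y} → Hom (X × T₀ Y) (T₀ (X × Y))
    stT-natural : ∀ {X X' Y Y'} (f : Hom X X') (g : Hom Y Y') →
                  stT ∘ ⟨ f ∘ π₁ , T₁ g ∘ π₂ ⟩ ≡ T₁ ⟨ f ∘ π₁ , g ∘ π₂ ⟩ ∘ stT
    stT-unit : ∀ {Y} → T₁ π₂ ∘ stT {𝟙} {Y} ≡ π₂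
    stT-assoc : ∀ {X Y Z} →
                T₁ ⟨ π₁ ∘ π₁ , ⟨ π₂ ∘ π₁ , π₂ ⟩ ⟩ ∘ stT {X × Y} {Z}
                ≡ stT ∘ ⟨ π₁ , stT ∘ π₂ ⟩ ∘ ⟨ π₁ ∘ π₁ , ⟨ π₂ ∘ π₁ , π₂ ⟩ ⟩
    stT-η : ∀ {X Y} → stT ∘ ⟨ π₁ , η ∘ π₂ ⟩ ≡ η {X × Y}
    stT-μ : ∀ {X Y} → stT ∘ ⟨ π₁ , μ ∘ π₂ ⟩ ≡ μ ∘ T₁ stT ∘ stT {X} {T₀ Y}

    F₀ : Obj → Obj
    F₁ : ∀ {X Y} → Hom X Y → Hom (F₀ X) (F₀ Y)
    F-id : ∀ {X} → F₁ (id {X}) ≡ id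
    F-∘ : ∀ {X Y Z} {f : Hom Y Z} {g : Hom X Y} → F₁ (f ∘ g) ≡ F₁ f ∘ F₁ g
    stF : ∀ {X Y} → Hom (X × F₀ Y) (F₀ (X × Y))
    stF-natural : ∀ {X X' Y Y'} (f : Hom X X') (g : Hom Y Y') →
                  stF ∘ ⟨ f ∘ π₁ , F₁ g ∘ π₂ ⟩ ≡ F₁ ⟨ f ∘ π₁ , g ∘ π₂ ⟩ ∘ stF
    stF-unit : ∀ {Y} → F₁ π₂ ∘ stF {𝟙} {Y} ≡ π₂
    stF-assoc : ∀ {X Y Z} →
                F₁ ⟨ π₁ ∘ π₁ , ⟨ π₂ ∘ π₁ , π₂ ⟩ ⟩ ∘ stF {X × Y} {Z}
                ≡ stF ∘ ⟨ π₁ , stF ∘ π₂ ⟩ ∘ ⟨ π₁ ∘ π₁ , ⟨ π₂ ∘ π₁ , π₂ ⟩ ⟩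

    lam : ∀ {X} → Hom (T₀ (F₀ X)) (F₀ (T₀ X))
    lam-natural : ∀ {X Y} (f : Hom X Y) → lam ∘ T₁ (F₁ f) ≡ F₁ (T₁ f) ∘ lam
    lam-η : ∀ {X} → lam ∘ η {F₀ X} ≡ F₁ (η {X})
    lam-μ : ∀ {X} → F₁ (μ {X}) ∘ lam ∘ T₁ lam ≡ lam ∘ μ
    lam-st : ∀ {X Y} →
             lam {X × Y} ∘ T₁ stF ∘ stT ≡ F₁ stT ∘ stF ∘ ⟨ π₁ , lam ∘ π₂ ⟩

    -- ordered object Ω: each Hom X Ω is a complete lattice (joins of
    -- arbitrary families), and precomposition preserves joins
    Ω : Obj
    _≤_ : ∀ {X} → Hom X Ω → Hom X Ω → Set ℓ
    ≤-refl : ∀ {X} {g : Hom X Ω} → g ≤ g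
    ≤-trans : ∀ {X} {g h k : Hom X Ω} → g ≤ h → h ≤ k → g ≤ k
    ≤-antisym : ∀ {X} {g h : Hom X Ω} → g ≤ h → h ≤ g → g ≡ h
    ⋁ : ∀ {X} {J : Set ℓ} → (J → Hom X Ω) → Hom X Ω
    ⋁-upper : ∀ {X} {J : Set ℓ} (f : J → Hom X Ω) (j : J) → f j ≤ ⋁ f
    ⋁-least : ∀ {X} {J : Set ℓ} (f : J → Hom X Ω) (g : Hom X Ω) →
              (∀ j → f j ≤ g) → ⋁ f ≤ g
    ⋁-precomp : ∀ {X Y} {J : Set ℓ} (f : J → Hom Y Ω) (h : Hom X Y) →
                ⋁ f ∘ h ≡ ⋁ (λ j → f j ∘ h)

    τ : Hom (F₀ (T₀ Ω)) Ω
    τ-monotone : ∀ {X} {g h : Hom X Ω} → g ≤ h → τ ∘ F₁ (T₁ g) ≤ τ ∘ F₁ (T₁ h)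

iter : ∀ {a} {B : Set a} → (B → B) → ℕ → B → B
iter f zero x = x
iter f (suc n) x = f (iter f n x)

module Derived {o ℓ} (𝒮 : Setting o ℓ) where
  open Setting 𝒮 public
  open ≡-Reasoning

  infixr 8 _×₁_
  _×₁_ : ∀ {X X' Y Y'} → Hom X X' → Hom Y Y' → Hom (X × Y) (X' × Y')
  f ×₁ g = ⟨ f ∘ π₁ , g ∘ π₂ ⟩

  swap : ∀ {X Y} → Hom (X × Y) (Y × X)
  swap = ⟨ π₂ , π₁ ⟩

  uncurry : ∀ {X Y Z} → Hom X (Z ^ Y) → Hom (X × Y) Z
  uncurry g = eval ∘ (g ×₁ id)

  _^₁_ : ∀ {Y Z} → Hom Y Z → (A : Obj) → Hom (Y ^ A) (Z ^ A)
  g ^₁ A = curry (g ∘ eval)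

  FT₀ : Obj → Obj
  FT₀ X = F₀ (T₀ X)

  FT₁ : ∀ {X Y} → Hom X Y → Hom (FT₀ X) (FT₀ Y)
  FT₁ f = F₁ (T₁ f)

  stTʳ : ∀ {X Y} → Hom (T₀ X × Y) (T₀ (X × Y))
  stTʳ = T₁ swap ∘ stT ∘ swap

  stFT : ∀ {X Y} → Hom (X × FT₀ Y) (FT₀ (X × Y))
  stFT = F₁ stT ∘ stF

  stFTʳ : ∀ {X Y} → Hom (FT₀ X × Y) (FT₀ (X × Y))
  stFTʳ = FT₁ swap ∘ stFT ∘ swap

  ⊥Ω : ∀ X → Hom X Ω
  ⊥Ω X = ⋁ {X} {⊥} ⊥-elim

  MonotoneAlg : (G₀ : Obj → Obj) → (∀ {X Y} → Hom X Y → Hom (G₀ X) (G₀ Y)) →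
                Hom (G₀ Ω) Ω → Set (o ⊔ ℓ)
  MonotoneAlg G₀ G₁ ρ = ∀ {X} {g h : Hom X Ω} → g ≤ h → ρ ∘ G₁ g ≤ ρ ∘ G₁ h

  IsEMAlgebra : Hom (T₀ Ω) Ω → Set ℓ
  IsEMAlgebra σ = Σ (σ ∘ η ≡ id) (λ _ → σ ∘ μ ≡ σ ∘ T₁ σ)

  Φ : ∀ {X} → Hom X (FT₀ X) → Hom X Ω → Hom X Ω
  Φ e g = τ ∘ FT₁ g ∘ e

  pow : Obj → ℕ → Obj
  pow X zero = 𝟙
  pow X (suc n) = X × pow X n

  Star : Obj → Obj
  Star X = ∐ (pow X)

  Plus : Obj → Obj
  Plus X = ∐ (λ n → pow X (suc n))

  -- cons_O : O × O* → O⁺ (the canonical isomorphism)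
  cons : ∀ {O} → Hom (O × Star O) (Plus O)
  cons {O} = uncurry (copair {D = pow O} (λ n → curry (inj {D = λ m → pow O (suc m)} n ∘ swap))) ∘ swap

  incl : ∀ {O} → Hom (Plus O) (Star O)
  incl {O} = copair (λ n → inj {D = pow O} (suc n))

  empty : ∀ {O} → Hom 𝟙 (Star O)
  empty {O} = inj {D = pow O} zero

  -- components of  A^{O*} ≅ A × A^{O⁺}
  headA : ∀ {A O} → Hom (A ^ Star O) A
  headA = eval ∘ ⟨ id , empty ∘ ! ⟩

  tailA : ∀ {A O} → Hom (A ^ Star O) (A ^ Plus O)
  tailA = curry (eval ∘ (id ×₁ incl))

  -- ev : O × A^{O⁺} → A^{O*},  (o,h) ↦ (w ↦ h(cons(o,w)))
  evO : ∀ {A O} → Hom (O × (A ^ Plus O)) (A ^ Star O)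
  evO = curry (eval ∘ ⟨ π₂ ∘ π₁ , cons ∘ ⟨ π₁ ∘ π₁ , π₂ ⟩ ⟩)

  Sch : ∀ (A : Obj) {S O} → Hom S (FT₀ S ^ A) → Hom S O →
        Hom (S × (A ^ Star O)) (FT₀ (S × (A ^ Star O)))
  Sch A δ obs =
    FT₁ ⟨ π₁ , evO ∘ (obs ×₁ id) ⟩ ∘ stFTʳ ∘ (uncurry δ ×₁ id)
      ∘ ⟨ ⟨ π₁ , headA ∘ π₂ ⟩ , tailA ∘ π₂ ⟩

  V : ∀ (A : Obj) {I S O} → Hom I S → Hom S (FT₀ S ^ A) → Hom S O → Hom I Ω
  V A {I} {S} {O} i δ obs =
    ⋁ {J = Σ (Hom (Plus O) A) (λ _ → ℕ)}
      (λ { (u , n) → iter (Φ (Sch A δ obs)) n (⊥Ω (S × (A ^ Star O)))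
                       ∘ ⟨ id , curry (u ∘ cons) ∘ obs ⟩ ∘ i })

  Tb : ∀ {X O} → Hom X O → Obj
  Tb {X} {O} f = PB (T₁ f) (η {O})

  ι : ∀ {X O} (f : Hom X O) → Hom (Tb f) (T₀ X)
  ι f = pb₁

  Tb-o : ∀ {X O} (f : Hom X O) → Hom (Tb f) O
  Tb-o f = pb₂

  ηb : ∀ {X O} (f : Hom X O) → Hom X (Tb f)
  ηb f = pbu η f (sym (η-natural f))

  Tb₁ : ∀ {X Y O} {f : Hom X O} {g : Hom Y O} (h : Hom X Y) → g ∘ h ≡ f →
        Hom (Tb f) (Tb g)
  Tb₁ {f = f} {g} h e = pbu (T₁ h ∘ ι f) (Tb-o f) pf
    where
    pf : T₁ g ∘ (T₁ h ∘ ι f) ≡ η ∘ Tb-o f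
    pf = begin
      T₁ g ∘ (T₁ h ∘ ι f) ≡⟨ sym assoc ⟩
      (T₁ g ∘ T₁ h) ∘ ι f ≡⟨ cong (_∘ ι f) (sym T-∘) ⟩
      T₁ (g ∘ h) ∘ ι f    ≡⟨ cong (λ k → T₁ k ∘ ι f) e ⟩
      T₁ f ∘ ι f          ≡⟨ pb-comm ⟩
      η ∘ Tb-o f          ∎

  θ : ∀ {X O O'} (u : Hom O O') (f : Hom X O) → Hom (Tb f) (Tb (u ∘ f))
  θ u f = pbu (ι f) (u ∘ Tb-o f) pf
    where
    pf : T₁ (u ∘ f) ∘ ι f ≡ η ∘ (u ∘ Tb-o f)
    pf = begin
      T₁ (u ∘ f) ∘ ι f      ≡⟨ cong (_∘ ι f) T-∘ ⟩
      (T₁ u ∘ T₁ f) ∘ ι f   ≡⟨ assoc ⟩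
      T₁ u ∘ (T₁ f ∘ ι f)   ≡⟨ cong (T₁ u ∘_) pb-comm ⟩
      T₁ u ∘ (η ∘ Tb-o f)   ≡⟨ sym assoc ⟩
      (T₁ u ∘ η) ∘ Tb-o f   ≡⟨ cong (_∘ Tb-o f) (sym (η-natural u)) ⟩
      (η ∘ u) ∘ Tb-o f      ≡⟨ assoc ⟩
      η ∘ (u ∘ Tb-o f)      ∎

  flat : ∀ {X O} (f : Hom X O) → Hom (T₀ (Tb f)) (T₀ X)
  flat f = μ ∘ T₁ (ι f)

  record BeliefDecomposition : Set (o ⊔ ℓ) where
    field
      α : ∀ {X O} (f : Hom X O) → Hom (T₀ X) (T₀ (Tb f))
      α-natural : ∀ {X Y O} {f : Hom X O} {g : Hom Y O} (h : Hom X Y) (e : g ∘ h ≡ f) →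
                  T₁ (Tb₁ h e) ∘ α f ≡ α g ∘ T₁ h
      α-flat : ∀ {X O} (f : Hom X O) → flat f ∘ α f ≡ id
      α-θ : ∀ {X O O'} (u : Hom O O') (f : Hom X O) → In𝒪 u →
            T₁ (θ u f) ∘ α f ≡ α (u ∘ f)

  κ : ∀ (A : Obj) {Y} → Hom (T₀ (Y ^ A)) (T₀ Y ^ A)
  κ A = curry (T₁ eval ∘ stTʳ)

  lam' : ∀ (A : Obj) {X} → Hom (T₀ (F₀ X ^ A)) (FT₀ X ^ A)
  lam' A {X} = (lam {X} ^₁ A) ∘ κ A

  cBel : ∀ (A : Obj) (BD : BeliefDecomposition) {S O} →
         Hom S (FT₀ S ^ A) → (obs : Hom S O) → Hom (Tb obs) (FT₀ (Tb obs) ^ A)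
  cBel A BD {S} δ obs =
    (F₁ (α obs) ^₁ A) ∘ (F₁ (μ {S}) ^₁ A) ∘ lam' A ∘ T₁ δ ∘ ι obs
    where open BeliefDecomposition BD

module Submission where

-- The map ιst = stTʳ ∘ (ι obs ×₁ id) : T̄_O S × A^{O*} → T (S × A^{O*}) reads a belief, paired
-- with a scheduler, as a distribution over state/scheduler pairs.  It intertwines the two
-- scheduler coalgebras: F (μ ∘ T ιst) ∘ Sch(Bel c) = (Sch c)♯ ∘ ιst, where e♯ = F μ ∘ λ ∘ T e.
-- Flattening undoes the belief update because flat ∘ α = id, and hypothesis (2) says that the
-- observation attached to a belief is the observation of every state in it.  Hypothesis (1)
-- then makes g ↦ σ ∘ T g ∘ ιst commute with the predicate transformers Φ, so the n-th
-- approximant for Bel(i,c) is σ ∘ T (Φⁿ ⊥) ∘ ιst.  At the initial belief η ∘ i the map ιst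
-- yields a Dirac distribution, and σ ∘ η = id matches the two joins defining V term by term.

open import Data.Nat using (zero; suc)
open import Data.Product using (_,_; proj₁; proj₂)
open import Data.Empty.Polymorphic using (⊥-elim)
open import Relation.Binary.PropositionalEquality
  using (_≡_; refl; sym; trans; cong; cong₂; subst; module ≡-Reasoning)
open import Defs

module Theory {o ℓ} (𝒮 : Setting o ℓ) where
  open Derived 𝒮
  open ≡-Reasoning

  variable
    W X Y Z X′ : Obj
    a b c d f g h k x : Hom X Y

  infixr 4 _⟩∘⟨_ refl⟩∘⟨_
  infixl 5 _⟩∘⟨refl

  _⟩∘⟨_ : a ≡ b → c ≡ d → a ∘ c ≡ b ∘ d
  _⟩∘⟨_ = cong₂ _∘_

  refl⟩∘⟨_ : a ≡ b → c ∘ a ≡ c ∘ b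
  refl⟩∘⟨ e = cong (_ ∘_) e

  _⟩∘⟨refl : a ≡ b → a ∘ c ≡ b ∘ c
  e ⟩∘⟨refl = cong (_∘ _) e

  pullˡ : a ∘ b ≡ c → a ∘ (b ∘ x) ≡ c ∘ x
  pullˡ e = trans (sym assoc) (e ⟩∘⟨refl)

  pullʳ : b ∘ x ≡ c → (a ∘ b) ∘ x ≡ a ∘ c
  pullʳ e = trans assoc (refl⟩∘⟨ e)

  pushˡ : a ∘ b ≡ c → c ∘ x ≡ a ∘ (b ∘ x)
  pushˡ e = sym (pullˡ e)

  extendʳ : a ∘ b ≡ c ∘ d → a ∘ (b ∘ x) ≡ c ∘ (d ∘ x)
  extendʳ e = trans (pullˡ e) assoc

  cancelˡ : a ∘ b ≡ id → a ∘ (b ∘ x) ≡ x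
  cancelˡ e = trans (pullˡ e) identityˡ

  T-pull : T₁ f ∘ (T₁ g ∘ x) ≡ T₁ (f ∘ g) ∘ x
  T-pull = pullˡ (sym T-∘)

  F-pull : F₁ f ∘ (F₁ g ∘ x) ≡ F₁ (f ∘ g) ∘ x
  F-pull = pullˡ (sym F-∘)

  -- Products

  ⟨⟩∘ : ⟨ f , g ⟩ ∘ h ≡ ⟨ f ∘ h , g ∘ h ⟩
  ⟨⟩∘ = ⟨⟩-unique (pullˡ π₁-β) (pullˡ π₂-β)

  ⟨⟩-congˡ : a ≡ b → ⟨ a , c ⟩ ≡ ⟨ b , c ⟩
  ⟨⟩-congˡ e = cong₂ ⟨_,_⟩ e refl

  ⟨⟩-congʳ : a ≡ b → ⟨ c , a ⟩ ≡ ⟨ c , b ⟩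
  ⟨⟩-congʳ e = cong₂ ⟨_,_⟩ refl e

  ⟨π₁,π₂⟩ : ⟨ π₁ , π₂ ⟩ ≡ id {X × Y}
  ⟨π₁,π₂⟩ = sym (⟨⟩-unique identityʳ identityʳ)

  id×₁ : id {Z} ×₁ f ≡ ⟨ π₁ , f ∘ π₂ ⟩
  id×₁ = ⟨⟩-congˡ identityˡ

  ×₁∘⟨⟩ : (f ×₁ g) ∘ ⟨ a , b ⟩ ≡ ⟨ f ∘ a , g ∘ b ⟩
  ×₁∘⟨⟩ = trans ⟨⟩∘ (cong₂ ⟨_,_⟩ (pullʳ π₁-β) (pullʳ π₂-β))

  ×₁∘×₁ : (f ×₁ g) ∘ (h ×₁ k) ≡ (f ∘ h) ×₁ (g ∘ k)
  ×₁∘×₁ = trans ×₁∘⟨⟩ (cong₂ ⟨_,_⟩ (sym assoc) (sym assoc))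

  id×₁id : id ×₁ id ≡ id {X × Y}
  id×₁id = trans id×₁ (trans (⟨⟩-congʳ identityˡ) ⟨π₁,π₂⟩)

  ∘×₁id : (f ∘ g) ×₁ id {Z} ≡ (f ×₁ id) ∘ (g ×₁ id)
  ∘×₁id = sym (trans ×₁∘×₁ (cong (_ ×₁_) identityˡ))

  id×₁∘ : id {Z} ×₁ (f ∘ g) ≡ (id ×₁ f) ∘ (id ×₁ g)
  id×₁∘ = sym (trans ×₁∘×₁ (cong (_×₁ _) identityˡ))

  swap∘⟨⟩ : swap ∘ ⟨ a , b ⟩ ≡ ⟨ b , a ⟩
  swap∘⟨⟩ = trans ⟨⟩∘ (cong₂ ⟨_,_⟩ π₂-β π₁-β)

  swap∘swap : swap ∘ swap ≡ id {X × Y}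
  swap∘swap = trans swap∘⟨⟩ ⟨π₁,π₂⟩

  swap∘×₁ : swap ∘ (f ×₁ g) ≡ (g ×₁ f) ∘ swap
  swap∘×₁ = trans swap∘⟨⟩ (sym ×₁∘⟨⟩)

  assocʳ : Hom ((X × Y) × Z) (X × (Y × Z))
  assocʳ = ⟨ π₁ ∘ π₁ , ⟨ π₂ ∘ π₁ , π₂ ⟩ ⟩

  assocˡ : Hom (X × (Y × Z)) ((X × Y) × Z)
  assocˡ = ⟨ ⟨ π₁ , π₁ ∘ π₂ ⟩ , π₂ ∘ π₂ ⟩

  assocʳ∘⟨⟩ : assocʳ ∘ ⟨ ⟨ a , b ⟩ , c ⟩ ≡ ⟨ a , ⟨ b , c ⟩ ⟩
  assocʳ∘⟨⟩ = trans ⟨⟩∘ (cong₂ ⟨_,_⟩ (trans (pullʳ π₁-β) π₁-β)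
                         (trans ⟨⟩∘ (cong₂ ⟨_,_⟩ (trans (pullʳ π₁-β) π₂-β) π₂-β)))

  assocˡ∘⟨⟩ : assocˡ ∘ ⟨ a , ⟨ b , c ⟩ ⟩ ≡ ⟨ ⟨ a , b ⟩ , c ⟩
  assocˡ∘⟨⟩ = trans ⟨⟩∘ (cong₂ ⟨_,_⟩ (trans ⟨⟩∘ (cong₂ ⟨_,_⟩ π₁-β (trans (pullʳ π₂-β) π₁-β)))
                                     (trans (pullʳ π₂-β) π₂-β))

  assocʳ∘assocˡ : assocʳ ∘ assocˡ ≡ id {X × (Y × Z)}
  assocʳ∘assocˡ = trans assocʳ∘⟨⟩ (trans (⟨⟩-congʳ (sym (⟨⟩-unique refl refl))) ⟨π₁,π₂⟩)

  triple-ext : {f g : Hom ((X × Y) × Z) W} →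
               (∀ {U} (a : Hom U X) (b : Hom U Y) (c : Hom U Z) →
                  f ∘ ⟨ ⟨ a , b ⟩ , c ⟩ ≡ g ∘ ⟨ ⟨ a , b ⟩ , c ⟩) →
               f ≡ g
  triple-ext {f = f} {g} e = begin
    f                                    ≡⟨ trans (refl⟩∘⟨ generic≡id) identityʳ ⟨
    f ∘ ⟨ ⟨ π₁ ∘ π₁ , π₂ ∘ π₁ ⟩ , π₂ ⟩  ≡⟨ e _ _ _ ⟩
    g ∘ ⟨ ⟨ π₁ ∘ π₁ , π₂ ∘ π₁ ⟩ , π₂ ⟩  ≡⟨ trans (refl⟩∘⟨ generic≡id) identityʳ ⟩
    g                                    ∎
    where
    generic≡id : ⟨ ⟨ π₁ ∘ π₁ , π₂ ∘ π₁ ⟩ , π₂ ⟩ ≡ id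
    generic≡id = trans (⟨⟩-congˡ (trans (sym ⟨⟩∘) (trans (⟨π₁,π₂⟩ ⟩∘⟨refl) identityˡ))) ⟨π₁,π₂⟩

  uncurry-curry : uncurry (curry f) ≡ f
  uncurry-curry = trans (refl⟩∘⟨ ⟨⟩-congʳ identityˡ) curry-β

  uncurry-∘ : uncurry (g ∘ f) ≡ uncurry g ∘ (f ×₁ id)
  uncurry-∘ = trans (refl⟩∘⟨ ∘×₁id) (sym assoc)

  uncurry-^₁ : uncurry ((g ^₁ Z) ∘ f) ≡ g ∘ uncurry f
  uncurry-^₁ = trans uncurry-∘ (trans (uncurry-curry ⟩∘⟨refl) assoc)

  ⋁-cong : ∀ {J : Set ℓ} {f g : J → Hom X Ω} → (∀ j → f j ≡ g j) → ⋁ f ≡ ⋁ g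
  ⋁-cong {f = f} {g} e = ≤-antisym
    (⋁-least f (⋁ g) (λ j → subst (_≤ ⋁ g) (sym (e j)) (⋁-upper g j)))
    (⋁-least g (⋁ f) (λ j → subst (_≤ ⋁ f) (e j) (⋁-upper f j)))

  ⊥Ω-∘ : ⊥Ω Y ∘ h ≡ ⊥Ω X
  ⊥Ω-∘ {h = h} = ≤-antisym
    (subst (_≤ _) (sym (⋁-precomp ⊥-elim h)) (⋁-least _ _ λ ()))
    (⋁-least _ _ λ ())

  -- Right strengths

  module RightStrength
    (G₀ : Obj → Obj) (G₁ : ∀ {X Y} → Hom X Y → Hom (G₀ X) (G₀ Y))
    (G-id : ∀ {X} → G₁ (id {X}) ≡ id)
    (G-∘ : ∀ {X Y Z} {f : Hom Y Z} {g : Hom X Y} → G₁ (f ∘ g) ≡ G₁ f ∘ G₁ g)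
    (st : ∀ {X Y} → Hom (X × G₀ Y) (G₀ (X × Y)))
    (st-natural : ∀ {X X′ Y Y′} (f : Hom X X′) (g : Hom Y Y′) →
                  st ∘ (f ×₁ G₁ g) ≡ G₁ (f ×₁ g) ∘ st)
    where

    stʳ : Hom (G₀ X × Y) (G₀ (X × Y))
    stʳ = G₁ swap ∘ st ∘ swap

    G-swap-cancel : G₁ swap ∘ (G₁ swap ∘ x) ≡ x
    G-swap-cancel = trans (pullˡ (trans (sym G-∘) (trans (cong G₁ swap∘swap) G-id))) identityˡ

    stʳ-swap : stʳ ∘ swap ≡ G₁ swap ∘ st {X} {Y}
    stʳ-swap = trans (pullʳ (pullʳ swap∘swap)) (refl⟩∘⟨ identityʳ)

    stʳ-natural : stʳ ∘ (G₁ f ×₁ g) ≡ G₁ (f ×₁ g) ∘ stʳ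
    stʳ-natural {f = f} {g = g} = begin
      stʳ ∘ (G₁ f ×₁ g)                    ≡⟨ pullʳ (pullʳ swap∘×₁) ⟩
      G₁ swap ∘ st ∘ (g ×₁ G₁ f) ∘ swap    ≡⟨ refl⟩∘⟨ pullˡ (st-natural g f) ⟩
      G₁ swap ∘ (G₁ (g ×₁ f) ∘ st) ∘ swap  ≡⟨ trans (refl⟩∘⟨ assoc) (pullˡ (sym G-∘)) ⟩
      G₁ (swap ∘ (g ×₁ f)) ∘ st ∘ swap     ≡⟨ cong G₁ swap∘×₁ ⟩∘⟨refl ⟩
      G₁ ((f ×₁ g) ∘ swap) ∘ st ∘ swap     ≡⟨ trans (G-∘ ⟩∘⟨refl) assoc ⟩
      G₁ (f ×₁ g) ∘ stʳ                    ∎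

    stʳ-naturalʳ : stʳ ∘ (id {G₀ X} ×₁ g) ≡ G₁ (id ×₁ g) ∘ stʳ
    stʳ-naturalʳ = trans (refl⟩∘⟨ cong (_×₁ _) (sym G-id)) stʳ-natural

  open RightStrength T₀ T₁ T-id T-∘ stT stT-natural
    using () renaming ( G-swap-cancel to T-swap-cancel; stʳ-swap to stTʳ-swap
                      ; stʳ-natural to stTʳ-natural; stʳ-naturalʳ to stTʳ-naturalʳ)
  open RightStrength F₀ F₁ F-id F-∘ stF stF-natural
    using () renaming (stʳ to stFʳ; G-swap-cancel to F-swap-cancel; stʳ-natural to stFʳ-natural)

  stTʳ-η : stTʳ ∘ (η ×₁ id {Y}) ≡ η {X × Y}
  stTʳ-η = begin
    stTʳ ∘ (η ×₁ id)                 ≡⟨ pullʳ (pullʳ swap∘×₁) ⟩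
    T₁ swap ∘ stT ∘ (id ×₁ η) ∘ swap ≡⟨ refl⟩∘⟨ pullˡ (trans (refl⟩∘⟨ id×₁) stT-η) ⟩
    T₁ swap ∘ η ∘ swap               ≡⟨ pullˡ (sym (η-natural swap)) ⟩
    (η ∘ swap) ∘ swap                ≡⟨ trans (pullʳ swap∘swap) identityʳ ⟩
    η                                ∎

  stTʳ-μ : stTʳ ∘ (μ ×₁ id {Y}) ≡ μ ∘ T₁ stTʳ ∘ stTʳ {T₀ X} {Y}
  stTʳ-μ = begin
    stTʳ ∘ (μ ×₁ id)                        ≡⟨ pullʳ (pullʳ swap∘×₁) ⟩
    T₁ swap ∘ stT ∘ (id ×₁ μ) ∘ swap        ≡⟨ refl⟩∘⟨ pullˡ (trans (refl⟩∘⟨ id×₁) stT-μ) ⟩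
    T₁ swap ∘ (μ ∘ T₁ stT ∘ stT) ∘ swap     ≡⟨ refl⟩∘⟨ trans assoc (refl⟩∘⟨ assoc) ⟩
    T₁ swap ∘ μ ∘ T₁ stT ∘ stT ∘ swap       ≡⟨ extendʳ (sym (μ-natural swap)) ⟩
    μ ∘ T₁ (T₁ swap) ∘ T₁ stT ∘ stT ∘ swap  ≡⟨ refl⟩∘⟨ T-pull ⟩
    μ ∘ T₁ (T₁ swap ∘ stT) ∘ stT ∘ swap     ≡⟨ refl⟩∘⟨ cong T₁ stTʳ-swap ⟩∘⟨refl ⟨
    μ ∘ T₁ (stTʳ ∘ swap) ∘ stT ∘ swap       ≡⟨ refl⟩∘⟨ trans (T-∘ ⟩∘⟨refl) assoc ⟩
    μ ∘ T₁ stTʳ ∘ stTʳ                      ∎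

  stT-assocˡ : stT ∘ (id ×₁ stT) ≡ T₁ assocʳ ∘ stT ∘ assocˡ {X} {Y} {T₀ Z}
  stT-assocˡ = begin
    stT ∘ (id ×₁ stT)                                ≡⟨ trans (refl⟩∘⟨ id×₁) (sym identityʳ) ⟩
    (stT ∘ ⟨ π₁ , stT ∘ π₂ ⟩) ∘ id                   ≡⟨ refl⟩∘⟨ assocʳ∘assocˡ ⟨
    (stT ∘ ⟨ π₁ , stT ∘ π₂ ⟩) ∘ assocʳ ∘ assocˡ      ≡⟨ pullˡ (trans assoc (sym stT-assoc)) ⟩
    (T₁ assocʳ ∘ stT) ∘ assocˡ                        ≡⟨ assoc ⟩
    T₁ assocʳ ∘ stT ∘ assocˡ                          ∎

  stTʳ-assoc : ∀ {X Y Z} → stTʳ ∘ (stTʳ ×₁ id {Z}) ≡ T₁ assocˡ ∘ stTʳ ∘ assocʳ {T₀ X} {Y} {Z}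
  stTʳ-assoc {X} {Y} {Z} = begin
    stTʳ ∘ (stTʳ ×₁ id)
      ≡⟨ pullʳ (pullʳ swap∘×₁) ⟩
    T₁ swap ∘ stT ∘ (id ×₁ stTʳ) ∘ swap
      ≡⟨ refl⟩∘⟨ pullˡ inner ⟩
    T₁ swap ∘ (T₁ (id ×₁ swap) ∘ T₁ assocʳ ∘ stT ∘ assocˡ ∘ (id ×₁ swap)) ∘ swap
      ≡⟨ trans (refl⟩∘⟨ trans assoc (refl⟩∘⟨ trans assoc (refl⟩∘⟨ assoc)))
               (trans (refl⟩∘⟨ T-pull) T-pull) ⟩
    T₁ (swap ∘ (id ×₁ swap) ∘ assocʳ) ∘ stT ∘ (assocˡ ∘ (id ×₁ swap)) ∘ swap
      ≡⟨ refl⟩∘⟨ refl⟩∘⟨ trans assoc reshuffle ⟩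
    T₁ (swap ∘ (id ×₁ swap) ∘ assocʳ) ∘ stT ∘ (swap ×₁ id) ∘ swap ∘ assocʳ
      ≡⟨ refl⟩∘⟨ pullˡ (trans (refl⟩∘⟨ cong (_ ×₁_) (sym T-id)) (stT-natural swap id)) ⟩
    T₁ (swap ∘ (id ×₁ swap) ∘ assocʳ) ∘ (T₁ (swap ×₁ id) ∘ stT) ∘ swap ∘ assocʳ
      ≡⟨ trans (refl⟩∘⟨ assoc) T-pull ⟩
    T₁ ((swap ∘ (id ×₁ swap) ∘ assocʳ) ∘ (swap ×₁ id)) ∘ stT ∘ swap ∘ assocʳ
      ≡⟨ cong T₁ rotate ⟩∘⟨refl ⟩
    T₁ (assocˡ ∘ swap) ∘ stT ∘ swap ∘ assocʳ
      ≡⟨ trans (T-∘ ⟩∘⟨refl) (trans assoc (refl⟩∘⟨ sym (trans assoc (refl⟩∘⟨ assoc)))) ⟩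
    T₁ assocˡ ∘ stTʳ ∘ assocʳ
      ∎
    where
    inner : stT ∘ (id {Z} ×₁ stTʳ {X} {Y}) ≡ T₁ (id ×₁ swap) ∘ T₁ assocʳ ∘ stT ∘ assocˡ ∘ (id ×₁ swap)
    inner = begin
      stT ∘ (id ×₁ stTʳ)                                     ≡⟨ refl⟩∘⟨ trans id×₁∘ (refl⟩∘⟨ id×₁∘) ⟩
      stT ∘ (id ×₁ T₁ swap) ∘ (id ×₁ stT) ∘ (id ×₁ swap)     ≡⟨ pullˡ (stT-natural id swap) ⟩
      (T₁ (id ×₁ swap) ∘ stT) ∘ (id ×₁ stT) ∘ (id ×₁ swap)   ≡⟨ trans assoc (refl⟩∘⟨ pullˡ stT-assocˡ) ⟩
      T₁ (id ×₁ swap) ∘ (T₁ assocʳ ∘ stT ∘ assocˡ) ∘ (id ×₁ swap)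
                                                             ≡⟨ refl⟩∘⟨ trans assoc (refl⟩∘⟨ assoc) ⟩
      T₁ (id ×₁ swap) ∘ T₁ assocʳ ∘ stT ∘ assocˡ ∘ (id ×₁ swap) ∎

    reshuffle : assocˡ ∘ (id ×₁ swap) ∘ swap ≡ (swap ×₁ id) ∘ swap ∘ assocʳ {T₀ X} {Y} {Z}
    reshuffle = triple-ext λ a b c → begin
      (assocˡ ∘ (id ×₁ swap) ∘ swap) ∘ ⟨ ⟨ a , b ⟩ , c ⟩  ≡⟨ pullʳ (pullʳ swap∘⟨⟩) ⟩
      assocˡ ∘ (id ×₁ swap) ∘ ⟨ c , ⟨ a , b ⟩ ⟩            ≡⟨ refl⟩∘⟨ trans ×₁∘⟨⟩ (cong₂ ⟨_,_⟩ identityˡ swap∘⟨⟩) ⟩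
      assocˡ ∘ ⟨ c , ⟨ b , a ⟩ ⟩                           ≡⟨ assocˡ∘⟨⟩ ⟩
      ⟨ ⟨ c , b ⟩ , a ⟩                                    ≡⟨ trans ×₁∘⟨⟩ (cong₂ ⟨_,_⟩ swap∘⟨⟩ identityˡ) ⟨
      (swap ×₁ id) ∘ ⟨ ⟨ b , c ⟩ , a ⟩                     ≡⟨ refl⟩∘⟨ trans (pullʳ assocʳ∘⟨⟩) swap∘⟨⟩ ⟨
      (swap ×₁ id) ∘ (swap ∘ assocʳ) ∘ ⟨ ⟨ a , b ⟩ , c ⟩   ≡⟨ sym assoc ⟩
      ((swap ×₁ id) ∘ swap ∘ assocʳ) ∘ ⟨ ⟨ a , b ⟩ , c ⟩   ∎

    rotate : (swap ∘ (id ×₁ swap) ∘ assocʳ) ∘ (swap ×₁ id) ≡ assocˡ ∘ swap {Y × Z} {X}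
    rotate = triple-ext λ a b c → begin
      ((swap ∘ (id ×₁ swap) ∘ assocʳ) ∘ (swap ×₁ id)) ∘ ⟨ ⟨ a , b ⟩ , c ⟩
        ≡⟨ pullʳ (trans ×₁∘⟨⟩ (cong₂ ⟨_,_⟩ swap∘⟨⟩ identityˡ)) ⟩
      (swap ∘ (id ×₁ swap) ∘ assocʳ) ∘ ⟨ ⟨ b , a ⟩ , c ⟩
        ≡⟨ pullʳ (pullʳ assocʳ∘⟨⟩) ⟩
      swap ∘ (id ×₁ swap) ∘ ⟨ b , ⟨ a , c ⟩ ⟩
        ≡⟨ refl⟩∘⟨ trans ×₁∘⟨⟩ (cong₂ ⟨_,_⟩ identityˡ swap∘⟨⟩) ⟩
      swap ∘ ⟨ b , ⟨ c , a ⟩ ⟩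
        ≡⟨ trans swap∘⟨⟩ (sym assocˡ∘⟨⟩) ⟩
      assocˡ ∘ ⟨ c , ⟨ a , b ⟩ ⟩
        ≡⟨ pullʳ swap∘⟨⟩ ⟨
      (assocˡ ∘ swap) ∘ ⟨ ⟨ a , b ⟩ , c ⟩
        ∎

  stFTʳ-split : stFTʳ ≡ F₁ stTʳ ∘ stFʳ {T₀ X} {Y}
  stFTʳ-split = sym (begin
    F₁ (T₁ swap ∘ stT ∘ swap) ∘ F₁ swap ∘ stF ∘ swap        ≡⟨ F-∘ ⟩∘⟨refl ⟩
    (F₁ (T₁ swap) ∘ F₁ (stT ∘ swap)) ∘ F₁ swap ∘ stF ∘ swap  ≡⟨ pullʳ (F-∘ ⟩∘⟨refl) ⟩
    F₁ (T₁ swap) ∘ (F₁ stT ∘ F₁ swap) ∘ F₁ swap ∘ stF ∘ swap ≡⟨ refl⟩∘⟨ pullʳ F-swap-cancel ⟩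
    F₁ (T₁ swap) ∘ F₁ stT ∘ stF ∘ swap                       ≡⟨ refl⟩∘⟨ sym assoc ⟩
    F₁ (T₁ swap) ∘ (F₁ stT ∘ stF) ∘ swap                     ∎)

  λ-stʳ : F₁ stTʳ ∘ stFʳ ∘ (lam ×₁ id) ≡ lam ∘ T₁ stFʳ ∘ stTʳ {F₀ X} {Y}
  λ-stʳ = begin
    F₁ stTʳ ∘ stFʳ ∘ (lam ×₁ id)
      ≡⟨ trans (sym assoc) (trans (sym stFTʳ-split ⟩∘⟨refl) (pullʳ assoc)) ⟩
    F₁ (T₁ swap) ∘ (F₁ stT ∘ stF) ∘ swap ∘ (lam ×₁ id)
      ≡⟨ refl⟩∘⟨ refl⟩∘⟨ swap∘×₁ ⟩
    F₁ (T₁ swap) ∘ (F₁ stT ∘ stF) ∘ (id ×₁ lam) ∘ swap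
      ≡⟨ refl⟩∘⟨ pullˡ (pullʳ (refl⟩∘⟨ id×₁)) ⟩
    F₁ (T₁ swap) ∘ (F₁ stT ∘ stF ∘ ⟨ π₁ , lam ∘ π₂ ⟩) ∘ swap
      ≡⟨ refl⟩∘⟨ sym lam-st ⟩∘⟨refl ⟩
    F₁ (T₁ swap) ∘ (lam ∘ T₁ stF ∘ stT) ∘ swap
      ≡⟨ refl⟩∘⟨ trans assoc (refl⟩∘⟨ assoc) ⟩
    F₁ (T₁ swap) ∘ lam ∘ T₁ stF ∘ stT ∘ swap
      ≡⟨ extendʳ (sym (lam-natural swap)) ⟩
    lam ∘ T₁ (F₁ swap) ∘ T₁ stF ∘ stT ∘ swap
      ≡⟨ refl⟩∘⟨ refl⟩∘⟨ refl⟩∘⟨ T-swap-cancel ⟨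
    lam ∘ T₁ (F₁ swap) ∘ T₁ stF ∘ T₁ swap ∘ T₁ swap ∘ stT ∘ swap
      ≡⟨ refl⟩∘⟨ trans (refl⟩∘⟨ T-pull) T-pull ⟩
    lam ∘ T₁ stFʳ ∘ stTʳ
      ∎

  -- Determinisation and transfer of approximants

  infix 10 _♯

  _♯ : Hom X (FT₀ Y) → Hom (T₀ X) (FT₀ Y)
  e ♯ = F₁ μ ∘ lam ∘ T₁ e

  ♯-∘ : ∀ {e : Hom Y (FT₀ Z)} → (e ∘ f) ♯ ≡ e ♯ ∘ T₁ f
  ♯-∘ = trans (refl⟩∘⟨ refl⟩∘⟨ T-∘) (sym (trans assoc (refl⟩∘⟨ assoc)))

  FT₁-♯ : ∀ {e : Hom X (FT₀ Y)} → FT₁ g ∘ e ♯ ≡ (FT₁ g ∘ e) ♯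
  FT₁-♯ {g = g} {e = e} = begin
    F₁ (T₁ g) ∘ F₁ μ ∘ lam ∘ T₁ e       ≡⟨ extendʳ (trans (sym F-∘) (trans (cong F₁ (sym (μ-natural g))) F-∘)) ⟩
    F₁ μ ∘ F₁ (T₁ (T₁ g)) ∘ lam ∘ T₁ e  ≡⟨ refl⟩∘⟨ extendʳ (sym (lam-natural (T₁ g))) ⟩
    F₁ μ ∘ lam ∘ T₁ (F₁ (T₁ g)) ∘ T₁ e  ≡⟨ refl⟩∘⟨ refl⟩∘⟨ sym T-∘ ⟩
    F₁ μ ∘ lam ∘ T₁ (FT₁ g ∘ e)         ∎

  ♯-strength : ∀ {e : Hom X (FT₀ Y)} → stFTʳ ∘ (e ♯ ×₁ id {Z}) ≡ (stFTʳ ∘ (e ×₁ id)) ♯ ∘ stTʳ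
  ♯-strength {e = e} = begin
    stFTʳ ∘ ((F₁ μ ∘ lam ∘ T₁ e) ×₁ id)
      ≡⟨ stFTʳ-split ⟩∘⟨ trans ∘×₁id (refl⟩∘⟨ ∘×₁id) ⟩
    (F₁ stTʳ ∘ stFʳ) ∘ (F₁ μ ×₁ id) ∘ (lam ×₁ id) ∘ (T₁ e ×₁ id)
      ≡⟨ pullʳ (pullˡ stFʳ-natural) ⟩
    F₁ stTʳ ∘ (F₁ (μ ×₁ id) ∘ stFʳ) ∘ (lam ×₁ id) ∘ (T₁ e ×₁ id)
      ≡⟨ trans (refl⟩∘⟨ assoc) (pullˡ (sym F-∘)) ⟩
    F₁ (stTʳ ∘ (μ ×₁ id)) ∘ stFʳ ∘ (lam ×₁ id) ∘ (T₁ e ×₁ id)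
      ≡⟨ trans (cong F₁ stTʳ-μ ⟩∘⟨refl) (trans (F-∘ ⟩∘⟨refl) assoc) ⟩
    F₁ μ ∘ F₁ (T₁ stTʳ ∘ stTʳ) ∘ stFʳ ∘ (lam ×₁ id) ∘ (T₁ e ×₁ id)
      ≡⟨ refl⟩∘⟨ trans (F-∘ ⟩∘⟨refl) (trans assoc (refl⟩∘⟨ sym assoc)) ⟩
    F₁ μ ∘ F₁ (T₁ stTʳ) ∘ (F₁ stTʳ ∘ stFʳ) ∘ (lam ×₁ id) ∘ (T₁ e ×₁ id)
      ≡⟨ refl⟩∘⟨ refl⟩∘⟨ trans (sym assoc) (trans (trans assoc λ-stʳ ⟩∘⟨refl) assoc) ⟩
    F₁ μ ∘ F₁ (T₁ stTʳ) ∘ lam ∘ (T₁ stFʳ ∘ stTʳ) ∘ (T₁ e ×₁ id)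
      ≡⟨ refl⟩∘⟨ extendʳ (sym (lam-natural stTʳ)) ⟩
    F₁ μ ∘ lam ∘ T₁ (F₁ stTʳ) ∘ (T₁ stFʳ ∘ stTʳ) ∘ (T₁ e ×₁ id)
      ≡⟨ refl⟩∘⟨ refl⟩∘⟨ refl⟩∘⟨ pullʳ stTʳ-natural ⟩
    F₁ μ ∘ lam ∘ T₁ (F₁ stTʳ) ∘ T₁ stFʳ ∘ T₁ (e ×₁ id) ∘ stTʳ
      ≡⟨ refl⟩∘⟨ refl⟩∘⟨ trans (refl⟩∘⟨ T-pull) T-pull ⟩
    F₁ μ ∘ lam ∘ T₁ (F₁ stTʳ ∘ stFʳ ∘ (e ×₁ id)) ∘ stTʳ
      ≡⟨ refl⟩∘⟨ refl⟩∘⟨ cong T₁ (trans (sym assoc) (sym stFTʳ-split ⟩∘⟨refl)) ⟩∘⟨refl ⟩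
    F₁ μ ∘ lam ∘ T₁ (stFTʳ ∘ (e ×₁ id)) ∘ stTʳ
      ≡⟨ trans (refl⟩∘⟨ sym assoc) (sym assoc) ⟩
    (stFTʳ ∘ (e ×₁ id)) ♯ ∘ stTʳ
      ∎

  -- implies, with lam-μ, that μ ∘ T₁ m is an F-coalgebra morphism from e′ ♯ to e ♯
  KleisliHomomorphism : Hom X′ (FT₀ X′) → Hom X (FT₀ X) → Hom X′ (T₀ X) → Set ℓ
  KleisliHomomorphism e′ e m = F₁ (μ ∘ T₁ m) ∘ e′ ≡ e ♯ ∘ m

  module Transfer
    (ρ : Hom (F₀ Ω) Ω) (σ : Hom (T₀ Ω) Ω) (τ≡ρ∘Fσ : τ ≡ ρ ∘ F₁ σ) (σ-EM : IsEMAlgebra σ)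
    (σ∘Tρ : σ ∘ T₁ ρ ≡ ρ ∘ F₁ σ ∘ lam)
    where

    σ∘T-μ : (g : Hom X Ω) → σ ∘ T₁ (σ ∘ T₁ g) ≡ (σ ∘ T₁ g) ∘ μ
    σ∘T-μ g = begin
      σ ∘ T₁ (σ ∘ T₁ g)     ≡⟨ refl⟩∘⟨ T-∘ ⟩
      σ ∘ T₁ σ ∘ T₁ (T₁ g)  ≡⟨ pullˡ (sym (proj₂ σ-EM)) ⟩
      (σ ∘ μ) ∘ T₁ (T₁ g)   ≡⟨ pullʳ (μ-natural g) ⟩
      σ ∘ T₁ g ∘ μ          ≡⟨ sym assoc ⟩
      (σ ∘ T₁ g) ∘ μ        ∎

    σ∘T-ρ : (g : Hom X Ω) → σ ∘ T₁ (ρ ∘ F₁ g) ≡ ρ ∘ F₁ (σ ∘ T₁ g) ∘ lam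
    σ∘T-ρ g = begin
      σ ∘ T₁ (ρ ∘ F₁ g)             ≡⟨ refl⟩∘⟨ T-∘ ⟩
      σ ∘ T₁ ρ ∘ T₁ (F₁ g)          ≡⟨ pullˡ σ∘Tρ ⟩
      (ρ ∘ F₁ σ ∘ lam) ∘ T₁ (F₁ g)  ≡⟨ pullʳ (pullʳ (lam-natural g)) ⟩
      ρ ∘ F₁ σ ∘ F₁ (T₁ g) ∘ lam    ≡⟨ refl⟩∘⟨ F-pull ⟩
      ρ ∘ F₁ (σ ∘ T₁ g) ∘ lam       ∎

    Φ-transfer : ∀ {e′ : Hom X′ (FT₀ X′)} {e : Hom X (FT₀ X)} {m : Hom X′ (T₀ X)} →
                 KleisliHomomorphism e′ e m →
                 (g : Hom X Ω) → Φ e′ (σ ∘ T₁ g ∘ m) ≡ σ ∘ T₁ (Φ e g) ∘ m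
    Φ-transfer {X′ = X′} {X = X} {e′ = e′} {e} {m} hom g = trans lhs (sym rhs)
      where
      ĝ : Hom (T₀ X) Ω
      ĝ = σ ∘ T₁ g

      lhs : Φ e′ (σ ∘ T₁ g ∘ m) ≡ ρ ∘ F₁ ĝ ∘ F₁ μ ∘ lam ∘ T₁ e ∘ m
      lhs = begin
        τ ∘ F₁ (T₁ (σ ∘ T₁ g ∘ m)) ∘ e′
          ≡⟨ trans (τ≡ρ∘Fσ ⟩∘⟨refl) (trans assoc (refl⟩∘⟨ F-pull)) ⟩
        ρ ∘ F₁ (σ ∘ T₁ (σ ∘ T₁ g ∘ m)) ∘ e′
          ≡⟨ refl⟩∘⟨ cong F₁ (refl⟩∘⟨ trans (cong T₁ (sym assoc)) T-∘) ⟩∘⟨refl ⟩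
        ρ ∘ F₁ (σ ∘ T₁ ĝ ∘ T₁ m) ∘ e′
          ≡⟨ refl⟩∘⟨ cong F₁ (trans (pullˡ (σ∘T-μ g)) assoc) ⟩∘⟨refl ⟩
        ρ ∘ F₁ (ĝ ∘ μ ∘ T₁ m) ∘ e′
          ≡⟨ refl⟩∘⟨ trans (F-∘ ⟩∘⟨refl) (trans assoc (refl⟩∘⟨ hom)) ⟩
        ρ ∘ F₁ ĝ ∘ (F₁ μ ∘ lam ∘ T₁ e) ∘ m
          ≡⟨ refl⟩∘⟨ refl⟩∘⟨ trans assoc (refl⟩∘⟨ assoc) ⟩
        ρ ∘ F₁ ĝ ∘ F₁ μ ∘ lam ∘ T₁ e ∘ m
          ∎

      rhs : σ ∘ T₁ (Φ e g) ∘ m ≡ ρ ∘ F₁ ĝ ∘ F₁ μ ∘ lam ∘ T₁ e ∘ m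
      rhs = begin
        σ ∘ T₁ (τ ∘ F₁ (T₁ g) ∘ e) ∘ m
          ≡⟨ refl⟩∘⟨ cong T₁ (trans (τ≡ρ∘Fσ ⟩∘⟨refl) (trans assoc (refl⟩∘⟨ F-pull))) ⟩∘⟨refl ⟩
        σ ∘ T₁ (ρ ∘ F₁ ĝ ∘ e) ∘ m
          ≡⟨ refl⟩∘⟨ trans (trans (cong T₁ (sym assoc)) T-∘ ⟩∘⟨refl) assoc ⟩
        σ ∘ T₁ (ρ ∘ F₁ ĝ) ∘ T₁ e ∘ m
          ≡⟨ trans (pullˡ (σ∘T-ρ ĝ)) (trans assoc (refl⟩∘⟨ assoc)) ⟩
        ρ ∘ F₁ (σ ∘ T₁ ĝ) ∘ lam ∘ T₁ e ∘ m
          ≡⟨ refl⟩∘⟨ trans (cong F₁ (σ∘T-μ g) ⟩∘⟨refl) (trans (F-∘ ⟩∘⟨refl) assoc) ⟩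
        ρ ∘ F₁ ĝ ∘ F₁ μ ∘ lam ∘ T₁ e ∘ m
          ∎

    iterΦ-transfer : ∀ {e′ : Hom X′ (FT₀ X′)} {e : Hom X (FT₀ X)} {m : Hom X′ (T₀ X)} →
                     (∀ Y → ⊥Ω (T₀ Y) ≡ σ ∘ T₁ (⊥Ω Y)) → KleisliHomomorphism e′ e m →
                     ∀ n → iter (Φ e′) n (⊥Ω X′) ≡ σ ∘ T₁ (iter (Φ e) n (⊥Ω X)) ∘ m
    iterΦ-transfer ⊥-strict hom zero    = sym (trans (sym assoc) (trans (sym (⊥-strict _) ⟩∘⟨refl) ⊥Ω-∘))
    iterΦ-transfer ⊥-strict hom (suc n) =
      trans (cong (Φ _) (iterΦ-transfer ⊥-strict hom n)) (Φ-transfer hom _)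

    transfer-at-η : ∀ {m : Hom X′ (T₀ X)} {j′ : Hom Y X′} {j : Hom Y X} → m ∘ j′ ≡ η ∘ j →
                    (g : Hom X Ω) → (σ ∘ T₁ g ∘ m) ∘ j′ ≡ g ∘ j
    transfer-at-η {m = m} {j′} {j} m∘j′ g = begin
      (σ ∘ T₁ g ∘ m) ∘ j′  ≡⟨ pullʳ (pullʳ m∘j′) ⟩
      σ ∘ T₁ g ∘ η ∘ j     ≡⟨ refl⟩∘⟨ pullˡ (sym (η-natural g)) ⟩
      σ ∘ (η ∘ g) ∘ j      ≡⟨ pullˡ (trans (sym assoc) (proj₁ σ-EM ⟩∘⟨refl)) ⟩
      (id ∘ g) ∘ j         ≡⟨ identityˡ ⟩∘⟨refl ⟩
      g ∘ j                ∎

  -- Schedulers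

  uncurry-κ : ∀ {f : Hom X (Y ^ Z)} → uncurry (κ Z ∘ T₁ f) ≡ T₁ (uncurry f) ∘ stTʳ
  uncurry-κ {Z = Z} {f = f} = begin
    uncurry (κ Z ∘ T₁ f)             ≡⟨ uncurry-∘ ⟩
    uncurry (κ Z) ∘ (T₁ f ×₁ id)     ≡⟨ uncurry-curry ⟩∘⟨refl ⟩
    (T₁ eval ∘ stTʳ) ∘ (T₁ f ×₁ id)  ≡⟨ pullʳ stTʳ-natural ⟩
    T₁ eval ∘ T₁ (f ×₁ id) ∘ stTʳ    ≡⟨ pullˡ (sym T-∘) ⟩
    T₁ (uncurry f) ∘ stTʳ            ∎

  observe : ∀ {A O} → Hom X O → Hom (X × (A ^ Plus O)) (X × (A ^ Star O))
  observe f = ⟨ π₁ , evO ∘ (f ×₁ id) ⟩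

  observe-factor : ∀ {A O} {a : Hom X Y} {b : Hom X O} →
                   ⟨ a ∘ π₁ , evO ∘ (b ×₁ id) ⟩ ≡ (id ×₁ evO) ∘ assocʳ ∘ (⟨ a , b ⟩ ×₁ id {A ^ Plus O})
  observe-factor {a = a} {b} = sym (begin
    (id ×₁ evO) ∘ assocʳ ∘ (⟨ a , b ⟩ ×₁ id)                  ≡⟨ refl⟩∘⟨ refl⟩∘⟨ ⟨⟩-congˡ ⟨⟩∘ ⟩
    (id ×₁ evO) ∘ assocʳ ∘ ⟨ ⟨ a ∘ π₁ , b ∘ π₁ ⟩ , id ∘ π₂ ⟩  ≡⟨ refl⟩∘⟨ assocʳ∘⟨⟩ ⟩
    (id ×₁ evO) ∘ ⟨ a ∘ π₁ , ⟨ b ∘ π₁ , id ∘ π₂ ⟩ ⟩          ≡⟨ trans ×₁∘⟨⟩ (⟨⟩-congˡ identityˡ) ⟩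
    ⟨ a ∘ π₁ , evO ∘ (b ×₁ id) ⟩                              ∎)

  splitSchedule : ∀ {A O} → Hom (X × (A ^ Star O)) ((X × A) × (A ^ Plus O))
  splitSchedule = ⟨ ⟨ π₁ , headA ∘ π₂ ⟩ , tailA ∘ π₂ ⟩

  splitSchedule-factor : ∀ {A O} → splitSchedule {X} {A} {O} ≡ assocˡ ∘ (id ×₁ ⟨ headA , tailA ⟩)
  splitSchedule-factor = sym (trans (refl⟩∘⟨ cong₂ ⟨_,_⟩ identityˡ ⟨⟩∘) assocˡ∘⟨⟩)

  splitSchedule-natural : ∀ {A O} {f : Hom X Y} →
                          ((f ×₁ id) ×₁ id) ∘ splitSchedule {X} {A} {O} ≡ splitSchedule ∘ (f ×₁ id)
  splitSchedule-natural {A = A} {O} {f} = begin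
    ((f ×₁ id) ×₁ id) ∘ splitSchedule
      ≡⟨ trans ×₁∘⟨⟩ (cong₂ ⟨_,_⟩ (trans ×₁∘⟨⟩ (⟨⟩-congʳ identityˡ)) identityˡ) ⟩
    ⟨ ⟨ f ∘ π₁ , headA {A} {O} ∘ π₂ ⟩ , tailA ∘ π₂ ⟩
      ≡⟨ cong₂ ⟨_,_⟩ (cong₂ ⟨_,_⟩ (sym π₁-β) (ignores-f headA)) (ignores-f tailA) ⟩
    ⟨ ⟨ π₁ ∘ (f ×₁ id) , (headA ∘ π₂) ∘ (f ×₁ id) ⟩ , (tailA ∘ π₂) ∘ (f ×₁ id) ⟩
      ≡⟨ trans ⟨⟩∘ (⟨⟩-congˡ ⟨⟩∘) ⟨
    splitSchedule ∘ (f ×₁ id)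
      ∎
    where
    ignores-f : ∀ {Z} (t : Hom (A ^ Star O) Z) → t ∘ π₂ ≡ (t ∘ π₂) ∘ (f ×₁ id)
    ignores-f t = sym (pullʳ (trans π₂-β identityˡ))

  stTʳ-splitSchedule : ∀ {A O} →
                       stTʳ ∘ (stTʳ ×₁ id) ∘ splitSchedule ≡ T₁ splitSchedule ∘ stTʳ {X} {A ^ Star O}
  stTʳ-splitSchedule {A = A} {O} = begin
    stTʳ ∘ (stTʳ ×₁ id) ∘ splitSchedule               ≡⟨ refl⟩∘⟨ refl⟩∘⟨ splitSchedule-factor ⟩
    stTʳ ∘ (stTʳ ×₁ id) ∘ assocˡ ∘ (id ×₁ q)          ≡⟨ pullˡ stTʳ-assoc ⟩
    (T₁ assocˡ ∘ stTʳ ∘ assocʳ) ∘ assocˡ ∘ (id ×₁ q)  ≡⟨ pullʳ (pullʳ (cancelˡ assocʳ∘assocˡ)) ⟩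
    T₁ assocˡ ∘ stTʳ ∘ (id ×₁ q)                      ≡⟨ refl⟩∘⟨ stTʳ-naturalʳ ⟩
    T₁ assocˡ ∘ T₁ (id ×₁ q) ∘ stTʳ                   ≡⟨ pullˡ (sym T-∘) ⟩
    T₁ (assocˡ ∘ (id ×₁ q)) ∘ stTʳ                    ≡⟨ cong T₁ splitSchedule-factor ⟩∘⟨refl ⟨
    T₁ splitSchedule ∘ stTʳ                           ∎
    where
    q : Hom (A ^ Star O) (A × (A ^ Plus O))
    q = ⟨ headA , tailA ⟩

  -- Beliefs

  module Belief (BD : BeliefDecomposition) {S O : Obj} (obs : Hom S O) where
    open BeliefDecomposition BD

    ιst : Hom (Tb obs × W) (T₀ (S × W))
    ιst = stTʳ ∘ (ι obs ×₁ id)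

    ObsDeterminedByBelief : Set ℓ
    ObsDeterminedByBelief = T₁ ⟨ id , obs ⟩ ∘ ι obs ≡ stTʳ ∘ ⟨ ι obs , Tb-o obs ⟩

    ιst-ηb : ιst ∘ (ηb obs ×₁ id {W}) ≡ η
    ιst-ηb = begin
      ιst ∘ (ηb obs ×₁ id)             ≡⟨ pullʳ (sym ∘×₁id) ⟩
      stTʳ ∘ ((ι obs ∘ ηb obs) ×₁ id)  ≡⟨ refl⟩∘⟨ cong (_×₁ id) (pbu-β₁ (sym (η-natural obs))) ⟩
      stTʳ ∘ (η ×₁ id)                 ≡⟨ stTʳ-η ⟩
      η                                ∎

    ιst-initial : ∀ {w : Hom O W} (x : Hom Y S) →
                  ιst ∘ ⟨ id , w ∘ Tb-o obs ⟩ ∘ ηb obs ∘ x ≡ η ∘ ⟨ id , w ∘ obs ⟩ ∘ x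
    ιst-initial {w = w} x = begin
      ιst ∘ ⟨ id , w ∘ Tb-o obs ⟩ ∘ ηb obs ∘ x       ≡⟨ refl⟩∘⟨ trans (pullˡ pairing) assoc ⟩
      ιst ∘ (ηb obs ×₁ id) ∘ ⟨ id , w ∘ obs ⟩ ∘ x    ≡⟨ pullˡ ιst-ηb ⟩
      η ∘ ⟨ id , w ∘ obs ⟩ ∘ x                       ∎
      where
      pairing : ⟨ id , w ∘ Tb-o obs ⟩ ∘ ηb obs ≡ (ηb obs ×₁ id) ∘ ⟨ id , w ∘ obs ⟩
      pairing = trans ⟨⟩∘ (trans (cong₂ ⟨_,_⟩ (trans identityˡ (sym identityʳ))
                                              (trans (pullʳ (pbu-β₂ _)) (sym identityˡ)))
                                 (sym ×₁∘⟨⟩))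

    μTιst-α : μ ∘ T₁ ιst ∘ stTʳ ∘ (α obs ×₁ id {W}) ≡ stTʳ
    μTιst-α = begin
      μ ∘ T₁ (stTʳ ∘ (ι obs ×₁ id)) ∘ stTʳ ∘ (α obs ×₁ id)
        ≡⟨ refl⟩∘⟨ trans (T-∘ ⟩∘⟨refl) assoc ⟩
      μ ∘ T₁ stTʳ ∘ T₁ (ι obs ×₁ id) ∘ stTʳ ∘ (α obs ×₁ id)
        ≡⟨ refl⟩∘⟨ refl⟩∘⟨ pullˡ (sym stTʳ-natural) ⟩
      μ ∘ T₁ stTʳ ∘ (stTʳ ∘ (T₁ (ι obs) ×₁ id)) ∘ (α obs ×₁ id)
        ≡⟨ trans (refl⟩∘⟨ trans (refl⟩∘⟨ assoc) (sym assoc)) (sym assoc) ⟩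
      (μ ∘ T₁ stTʳ ∘ stTʳ) ∘ (T₁ (ι obs) ×₁ id) ∘ (α obs ×₁ id)
        ≡⟨ pushˡ stTʳ-μ ⟩
      stTʳ ∘ (μ ×₁ id) ∘ (T₁ (ι obs) ×₁ id) ∘ (α obs ×₁ id)
        ≡⟨ refl⟩∘⟨ trans (refl⟩∘⟨ sym ∘×₁id) (sym ∘×₁id) ⟩
      stTʳ ∘ ((μ ∘ T₁ (ι obs) ∘ α obs) ×₁ id)
        ≡⟨ refl⟩∘⟨ cong (_×₁ id) (trans (sym assoc) (α-flat obs)) ⟩
      stTʳ ∘ (id ×₁ id)
        ≡⟨ trans (refl⟩∘⟨ id×₁id) identityʳ ⟩
      stTʳ
        ∎

    FμTιst-α : F₁ (μ ∘ T₁ ιst) ∘ stFTʳ ∘ (F₁ (α obs) ×₁ id {W}) ≡ stFTʳ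
    FμTιst-α = begin
      F₁ (μ ∘ T₁ ιst) ∘ stFTʳ ∘ (F₁ (α obs) ×₁ id)         ≡⟨ refl⟩∘⟨ trans (stFTʳ-split ⟩∘⟨refl) (pullʳ stFʳ-natural) ⟩
      F₁ (μ ∘ T₁ ιst) ∘ F₁ stTʳ ∘ F₁ (α obs ×₁ id) ∘ stFʳ  ≡⟨ trans (refl⟩∘⟨ F-pull) F-pull ⟩
      F₁ ((μ ∘ T₁ ιst) ∘ stTʳ ∘ (α obs ×₁ id)) ∘ stFʳ     ≡⟨ cong F₁ (trans assoc μTιst-α) ⟩∘⟨refl ⟩
      F₁ stTʳ ∘ stFʳ                                       ≡⟨ stFTʳ-split ⟨
      stFTʳ                                                ∎

    ιst-splitSchedule : ∀ {A} → stTʳ ∘ (ιst ×₁ id) ∘ splitSchedule ≡ T₁ splitSchedule ∘ ιst {A ^ Star O}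
    ιst-splitSchedule = begin
      stTʳ ∘ (ιst ×₁ id) ∘ splitSchedule                             ≡⟨ refl⟩∘⟨ ∘×₁id ⟩∘⟨refl ⟩
      stTʳ ∘ ((stTʳ ×₁ id) ∘ ((ι obs ×₁ id) ×₁ id)) ∘ splitSchedule  ≡⟨ refl⟩∘⟨ pullʳ splitSchedule-natural ⟩
      stTʳ ∘ (stTʳ ×₁ id) ∘ splitSchedule ∘ (ι obs ×₁ id)            ≡⟨ trans (refl⟩∘⟨ sym assoc) (sym assoc) ⟩
      (stTʳ ∘ (stTʳ ×₁ id) ∘ splitSchedule) ∘ (ι obs ×₁ id)          ≡⟨ pushˡ (sym stTʳ-splitSchedule) ⟩
      T₁ splitSchedule ∘ ιst                                         ∎

    ιst-observe : ∀ {A} → ObsDeterminedByBelief →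
                  ιst ∘ observe (Tb-o obs) ≡ T₁ (observe obs) ∘ ιst {A ^ Plus O}
    ιst-observe {A} determined = sym (begin
      T₁ (observe obs) ∘ stTʳ ∘ (ι obs ×₁ id)
        ≡⟨ cong T₁ (trans (⟨⟩-congˡ (sym identityˡ)) observe-factor) ⟩∘⟨refl ⟩
      T₁ ((id ×₁ evO) ∘ assocʳ ∘ (⟨ id , obs ⟩ ×₁ id)) ∘ stTʳ ∘ (ι obs ×₁ id)
        ≡⟨ trans (T-∘ ⟩∘⟨refl) (trans assoc (refl⟩∘⟨ trans (T-∘ ⟩∘⟨refl) assoc)) ⟩
      T₁ (id ×₁ evO) ∘ T₁ assocʳ ∘ T₁ (⟨ id , obs ⟩ ×₁ id) ∘ stTʳ ∘ (ι obs ×₁ id)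
        ≡⟨ refl⟩∘⟨ refl⟩∘⟨ pullˡ (sym stTʳ-natural) ⟩
      T₁ (id ×₁ evO) ∘ T₁ assocʳ ∘ (stTʳ ∘ (T₁ ⟨ id , obs ⟩ ×₁ id)) ∘ (ι obs ×₁ id)
        ≡⟨ refl⟩∘⟨ refl⟩∘⟨ pullʳ (trans (sym ∘×₁id) (trans (cong (_×₁ id) determined) ∘×₁id)) ⟩
      T₁ (id ×₁ evO) ∘ T₁ assocʳ ∘ stTʳ ∘ (stTʳ ×₁ id) ∘ (⟨ ι obs , Tb-o obs ⟩ ×₁ id)
        ≡⟨ refl⟩∘⟨ refl⟩∘⟨ pullˡ stTʳ-assoc ⟩
      T₁ (id ×₁ evO) ∘ T₁ assocʳ ∘ (T₁ assocˡ ∘ stTʳ ∘ assocʳ) ∘ (⟨ ι obs , Tb-o obs ⟩ ×₁ id)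
        ≡⟨ refl⟩∘⟨ trans (refl⟩∘⟨ assoc) (cancelˡ T-assocʳ∘assocˡ) ⟩
      T₁ (id ×₁ evO) ∘ (stTʳ ∘ assocʳ) ∘ (⟨ ι obs , Tb-o obs ⟩ ×₁ id)
        ≡⟨ trans (refl⟩∘⟨ assoc) (pullˡ (sym stTʳ-naturalʳ)) ⟩
      (stTʳ ∘ (id ×₁ evO)) ∘ assocʳ ∘ (⟨ ι obs , Tb-o obs ⟩ ×₁ id)
        ≡⟨ pullʳ (sym observe-factor) ⟩
      stTʳ ∘ ⟨ ι obs ∘ π₁ , evO ∘ (Tb-o obs ×₁ id) ⟩
        ≡⟨ refl⟩∘⟨ trans ×₁∘⟨⟩ (⟨⟩-congʳ identityˡ) ⟨
      stTʳ ∘ (ι obs ×₁ id) ∘ observe (Tb-o obs)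
        ≡⟨ sym assoc ⟩
      ιst ∘ observe (Tb-o obs)
        ∎)
      where
      T-assocʳ∘assocˡ : T₁ assocʳ ∘ T₁ assocˡ ≡ id {T₀ (S × (O × (A ^ Plus O)))}
      T-assocʳ∘assocˡ = trans (sym T-∘) (trans (cong T₁ assocʳ∘assocˡ) T-id)

    FμTιst-observe : ∀ {A} → ObsDeterminedByBelief →
                     F₁ (μ ∘ T₁ ιst) ∘ FT₁ (observe {A = A} (Tb-o obs)) ≡ FT₁ (observe obs) ∘ F₁ (μ ∘ T₁ ιst)
    FμTιst-observe {A} determined = trans (sym F-∘) (trans (cong F₁ flat-observe) F-∘)
      where
      flat-observe : (μ ∘ T₁ ιst) ∘ T₁ (observe {A = A} (Tb-o obs)) ≡ T₁ (observe obs) ∘ μ ∘ T₁ ιst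
      flat-observe = begin
        (μ ∘ T₁ ιst) ∘ T₁ (observe (Tb-o obs))  ≡⟨ pullʳ (sym T-∘) ⟩
        μ ∘ T₁ (ιst ∘ observe (Tb-o obs))       ≡⟨ refl⟩∘⟨ trans (cong T₁ (ιst-observe determined)) T-∘ ⟩
        μ ∘ T₁ (T₁ (observe obs)) ∘ T₁ ιst       ≡⟨ extendʳ (μ-natural _) ⟩
        T₁ (observe obs) ∘ μ ∘ T₁ ιst            ∎

    uncurry-cBel : ∀ {A} (δ : Hom S (FT₀ S ^ A)) →
                   uncurry (cBel A BD δ obs) ≡ F₁ (α obs) ∘ uncurry δ ♯ ∘ ιst
    uncurry-cBel {A} δ = begin
      uncurry ((F₁ (α obs) ^₁ A) ∘ (F₁ μ ^₁ A) ∘ ((lam ^₁ A) ∘ κ A) ∘ T₁ δ ∘ ι obs)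
        ≡⟨ trans uncurry-^₁ (refl⟩∘⟨ uncurry-^₁) ⟩
      F₁ (α obs) ∘ F₁ μ ∘ uncurry (((lam ^₁ A) ∘ κ A) ∘ T₁ δ ∘ ι obs)
        ≡⟨ refl⟩∘⟨ refl⟩∘⟨ trans (cong uncurry assoc) uncurry-^₁ ⟩
      F₁ (α obs) ∘ F₁ μ ∘ lam ∘ uncurry (κ A ∘ T₁ δ ∘ ι obs)
        ≡⟨ refl⟩∘⟨ refl⟩∘⟨ refl⟩∘⟨ trans (cong uncurry (sym assoc)) (trans uncurry-∘ (uncurry-κ ⟩∘⟨refl)) ⟩
      F₁ (α obs) ∘ F₁ μ ∘ lam ∘ (T₁ (uncurry δ) ∘ stTʳ) ∘ (ι obs ×₁ id)
        ≡⟨ refl⟩∘⟨ trans (refl⟩∘⟨ refl⟩∘⟨ assoc) (sym (trans assoc (refl⟩∘⟨ assoc))) ⟩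
      F₁ (α obs) ∘ uncurry δ ♯ ∘ ιst
        ∎

    Sch-Bel-homomorphism : ∀ {A} (δ : Hom S (FT₀ S ^ A)) → ObsDeterminedByBelief →
                           KleisliHomomorphism (Sch A (cBel A BD δ obs) (Tb-o obs)) (Sch A δ obs) ιst
    Sch-Bel-homomorphism {A} δ determined = begin
      F₁ (μ ∘ T₁ ιst) ∘ FT₁ (observe (Tb-o obs)) ∘ stFTʳ ∘ (uncurry (cBel A BD δ obs) ×₁ id) ∘ splitSchedule
        ≡⟨ extendʳ (FμTιst-observe determined) ⟩
      FT₁ observeS ∘ F₁ (μ ∘ T₁ ιst) ∘ stFTʳ ∘ (uncurry (cBel A BD δ obs) ×₁ id) ∘ splitSchedule
        ≡⟨ refl⟩∘⟨ refl⟩∘⟨ refl⟩∘⟨ trans (cong (_×₁ id) (uncurry-cBel δ)) ∘×₁id ⟩∘⟨refl ⟩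
      FT₁ observeS ∘ F₁ (μ ∘ T₁ ιst) ∘ stFTʳ ∘ ((F₁ (α obs) ×₁ id) ∘ ((D ♯ ∘ ιst) ×₁ id)) ∘ splitSchedule
        ≡⟨ refl⟩∘⟨ trans (refl⟩∘⟨ trans (refl⟩∘⟨ assoc) (sym assoc)) (pullˡ FμTιst-α) ⟩
      FT₁ observeS ∘ stFTʳ ∘ ((D ♯ ∘ ιst) ×₁ id) ∘ splitSchedule
        ≡⟨ refl⟩∘⟨ refl⟩∘⟨ trans (∘×₁id ⟩∘⟨refl) assoc ⟩
      FT₁ observeS ∘ stFTʳ ∘ (D ♯ ×₁ id) ∘ (ιst ×₁ id) ∘ splitSchedule
        ≡⟨ refl⟩∘⟨ pullˡ ♯-strength ⟩
      FT₁ observeS ∘ (E ♯ ∘ stTʳ) ∘ (ιst ×₁ id) ∘ splitSchedule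
        ≡⟨ refl⟩∘⟨ trans assoc (refl⟩∘⟨ ιst-splitSchedule) ⟩
      FT₁ observeS ∘ E ♯ ∘ T₁ splitSchedule ∘ ιst
        ≡⟨ refl⟩∘⟨ pullˡ (sym ♯-∘) ⟩
      FT₁ observeS ∘ (E ∘ splitSchedule) ♯ ∘ ιst
        ≡⟨ pullˡ FT₁-♯ ⟩
      (FT₁ observeS ∘ E ∘ splitSchedule) ♯ ∘ ιst
        ≡⟨ cong (λ s → (FT₁ observeS ∘ s) ♯) assoc ⟩∘⟨refl ⟩
      Sch A δ obs ♯ ∘ ιst
        ∎
      where
      D : Hom (S × A) (FT₀ S)
      D = uncurry δ
      E : Hom ((S × A) × (A ^ Plus O)) (FT₀ (S × (A ^ Plus O)))
      E = stFTʳ ∘ (D ×₁ id)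
      observeS : Hom (S × (A ^ Plus O)) (S × (A ^ Star O))
      observeS = observe obs

theorem6p3 : ∀ {o ℓ} (𝒮 : Setting o ℓ) → let open Derived 𝒮 in
    ∀ (A I : Obj) (BD : BeliefDecomposition)
      {S O : Obj} (i : Hom I S) (δ : Hom S (FT₀ S ^ A)) (obs : Hom S O)
    -- hypothesis (1)
      (ρ : Hom (F₀ Ω) Ω) (σ : Hom (T₀ Ω) Ω) →
      τ ≡ ρ ∘ F₁ σ →
      MonotoneAlg F₀ F₁ ρ →
      MonotoneAlg T₀ T₁ σ →
      IsEMAlgebra σ →
      σ ∘ T₁ ρ ≡ ρ ∘ F₁ σ ∘ lam →
      (∀ X → ⊥Ω (T₀ X) ≡ σ ∘ T₁ (⊥Ω X)) →
    -- hypothesis (2)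
      T₁ ⟨ id , obs ⟩ ∘ ι obs ≡ stTʳ ∘ ⟨ ι obs , Tb-o obs ⟩ →
    -- conclusion: V(i,c) = V(Bel(i,c))
      V A i δ obs ≡ V A (ηb obs ∘ i) (cBel A BD δ obs) (Tb-o obs)
theorem6p3 𝒮 A I BD i δ obs ρ σ τ≡ρ∘Fσ _ _ σ-EM σ∘Tρ ⊥-strict determined =
  ⋁-cong λ { (u , n) → sym (trans
    (iterΦ-transfer ⊥-strict (Sch-Bel-homomorphism δ determined) n ⟩∘⟨refl)
    (transfer-at-η (ιst-initial i) _)) }
  where
  open Derived 𝒮
  open Theory 𝒮
  open Belief BD obs
  open Transfer ρ σ τ≡ρ∘Fσ σ-EM σ∘Tρ
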